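{- There exists a pushdown automaton $M$ with exactly two states such that there are no finite set $\mathcal{P}$ of process identifiers, guarded recursive specification $\Delta$ over TSP with sequencing, and identifier $X\in\mathcal{P}$ for which the process graph of $X$ is bisimilar to the process graph $\mathcal{P}(M)$ of $M$.
   Context: Process graphs and bisimilarity: a process graph is a tuple $(\mathcal{S},\mathcal{A},\to,\uparrow,\downarrow)$ with states $\mathcal{S}$, actions $\mathcal{A}$ (silent action $\tau\notin\mathcal{A}$), transitions $\to\subseteq\mathcal{S}\times(\mathcal{A}\cup\{\tau\})\times\mathcal{S}$, root $\uparrow$, accepting states $\downarrow\subseteq\mathcal{S}$. A bisimulation between two process graphs is a symmetric relation $R$ on the disjoint union of their states such that whenever $s\,R\,t$: if $s\xrightarrow{a}s'$ then $t\xrightarrow{a}t'$ for some $t'$ with $s'\,R\,t'$; and if $s$ is accepting so is $t$. Graphs are bisimilar if a bisimulation relates their roots. Pushdown automaton: $M=(\mathcal{S},\mathcal{A},\mathcal{D},\to,\uparrow,\downarrow)$ with finite state set $\mathcal{S}$, finite input alphabet $\mathcal{A}$ ($\tau\notin\mathcal{A}$), finite data alphabet $\mathcal{D}$, finite set of transitions $\to\subseteq\mathcal{S}\times(\mathcal{A}\cup\{\tau\})\times(\mathcal{D}\cup\{\epsilon\})\times\mathcal{D}^*\times\mathcal{S}$ (written $s\xrightarrow{a[d/x]}t$), initial state $\uparrow$, final states $\downarrow\subseteq\mathcal{S}$. Its process graph $\mathcal{P}(M)$ has states $(s,x)$, $s\in\mathcal{S}$, $x\in\mathcal{D}^*$ (leftmost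 symbol = top of stack); $(s,dx)\xrightarrow{a}(s',x'x)$ iff $s\xrightarrow{a[d/x']}s'$ ($d\in\mathcal{D}$); $(s,\epsilon)\xrightarrow{a}(s',x)$ iff $s\xrightarrow{a[\epsilon/x]}s'$; root $(\uparrow,\epsilon)$; accepting states all $(s,x)$ with $s\in\downarrow$. TSP with sequencing: fix actions $\mathit{Act}$ ($\tau\notin\mathit{Act}$) and a finite set $\mathcal{P}$ of identifiers. Expressions: $p::=0\mid 1\mid a.p\mid p+p\mid p;p\mid X$ ($a\in\mathit{Act}\cup\{\tau\}$, $X\in\mathcal{P}$). A recursive specification $\Delta$ assigns an expression $\Delta(X)$ to each $X\in\mathcal{P}$; it is guarded if every identifier occurrence in each right-hand side lies within the scope of an action prefix. Operational semantics: $1\downarrow$; $a.p\xrightarrow{a}p$; $(p+q)\downarrow$ if $p\downarrow$ or $q\downarrow$; $p+q\xrightarrow{a}p'$ if $p\xrightarrow{a}p'$ or $q\xrightarrow{a}p'$; $(p;q)\downarrow$ if $p\downarrow$ and $q\downarrow$; $p;q\xrightarrow{a}p';q$ if $p\xrightarrow{a}p'$; $p;q\xrightarrow{a}q'$ if $p\downarrow$, $p$ has no outgoing transitions, and $q\xrightarrow{a}q'$; $X\xrightarrow{a}p'$ if $\Delta(X)\xrightarrow{a}p'$; $X\downarrow$ if $\Delta(X)\downarrow$ (for guarded $\Delta$ these rules determine a unique transition relation). The process graph of $p$ has all expressions as states, this transition relation and acceptance predicate, and root $p$. -}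

module Defs where

open import Data.Nat using (ℕ)
open import Data.Fin using (Fin)
open import Data.Bool using (Bool; true)
open import Data.Maybe using (Maybe; just; nothing)
open import Data.List using (List; []; _∷_; _++_)
open import Data.List.Membership.Propositional using (_∈_)
open import Data.Product using (Σ; _×_; _,_)
open import Data.Sum using (_⊎_; inj₁; inj₂)
open import Data.Empty using (⊥)
open import Relation.Nullary using (¬_)
open import Relation.Binary.PropositionalEquality using (_≡_)
open import Function.Bundles using (_⇔_)

data Lab (A : Set) : Set where
  act : A → Lab A
  τ   : Lab A

mapLab : {A B : Set} → (A → B) → Lab A → Lab B
mapLab f (act a) = act (f a)
mapLab f τ       = τ

record ProcessGraph (Act : Set) : Set₁ where
  field
    State : Set
    Step  : State → Lab Act → State → Set
    root  : State
    Acc   : State → Set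

module _ {Act : Set} (G H : ProcessGraph Act) where
  private
    module G = ProcessGraph G
    module H = ProcessGraph H

  U : Set
  U = G.State ⊎ H.State

  data UStep : U → Lab Act → U → Set where
    left  : ∀ {s a s'} → G.Step s a s' → UStep (inj₁ s) a (inj₁ s')
    right : ∀ {t a t'} → H.Step t a t' → UStep (inj₂ t) a (inj₂ t')

  UAcc : U → Set
  UAcc (inj₁ s) = G.Acc s
  UAcc (inj₂ t) = H.Acc t

  record IsBisimulation (R : U → U → Set) : Set where
    field
      symmetric : ∀ {s t} → R s t → R t s
      transfer  : ∀ {s t a s'} → R s t → UStep s a s' →
                  Σ U λ t' → UStep t a t' × R s' t'
      accept    : ∀ {s t} → R s t → UAcc s → UAcc t

  Bisimilar : Set₁
  Bisimilar = Σ (U → U → Set) λ R →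
                IsBisimulation R × R (inj₁ G.root) (inj₂ H.root)

-- Pushdown automata with state set Fin s, input alphabet Fin n,
-- data alphabet Fin k.  A transition  src --a[d/x]--> tgt  where
-- pop = just d (d ∈ D) or nothing (ε), push = x.

record PDATrans (s n k : ℕ) : Set where
  field
    src  : Fin s
    lab  : Lab (Fin n)
    pop  : Maybe (Fin k)
    push : List (Fin k)
    tgt  : Fin s

record PDA (s n k : ℕ) : Set where
  field
    trans : List (PDATrans s n k)
    init  : Fin s
    final : Fin s → Bool

module _ {s n k : ℕ} {Act : Set} (ι : Fin n → Act) (M : PDA s n k) where
  open PDATrans
  open PDA M

  Config : Set
  Config = Fin s × List (Fin k)

  data PDAStep : Config → Lab Act → Config → Set where
    popStep   : ∀ {t d x} → t ∈ trans → pop t ≡ just d →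
                PDAStep (src t , d ∷ x) (mapLab ι (lab t)) (tgt t , push t ++ x)
    emptyStep : ∀ {t} → t ∈ trans → pop t ≡ nothing →
                PDAStep (src t , []) (mapLab ι (lab t)) (tgt t , push t)

  PDAAcc : Config → Set
  PDAAcc (q , _) = final q ≡ true

  PDAGraph : ProcessGraph Act
  PDAGraph = record
    { State = Config
    ; Step  = PDAStep
    ; root  = init , []
    ; Acc   = PDAAcc
    }

data Expr (Act : Set) (m : ℕ) : Set where
  𝟘    : Expr Act m
  𝟙    : Expr Act m
  _·_  : Lab Act → Expr Act m → Expr Act m
  _⊕_  : Expr Act m → Expr Act m → Expr Act m
  _⨾_  : Expr Act m → Expr Act m → Expr Act m
  var  : Fin m → Expr Act m

data Guarded {Act : Set} {m : ℕ} : Expr Act m → Set where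
  g𝟘 : Guarded 𝟘
  g𝟙 : Guarded 𝟙
  g· : ∀ {a p} → Guarded (a · p)
  g⊕ : ∀ {p q} → Guarded p → Guarded q → Guarded (p ⊕ q)
  g⨾ : ∀ {p q} → Guarded p → Guarded q → Guarded (p ⨾ q)

Spec : Set → ℕ → Set
Spec Act m = Fin m → Expr Act m

GuardedSpec : {Act : Set} {m : ℕ} → Spec Act m → Set
GuardedSpec Δ = ∀ X → Guarded (Δ X)

module _ {Act : Set} {m : ℕ} (Δ : Spec Act m) where

  -- termination predicate (no negative premises: inductive)
  data Term : Expr Act m → Set where
    t𝟙  : Term 𝟙
    t⊕ˡ : ∀ {p q} → Term p → Term (p ⊕ q)
    t⊕ʳ : ∀ {p q} → Term q → Term (p ⊕ q)
    t⨾  : ∀ {p q} → Term p → Term q → Term (p ⨾ q)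
    tX  : ∀ {X} → Term (Δ X) → Term (var X)

  -- The transition rules, read against a candidate relation T
  -- (the sequencing rule has the negative premise "p has no transitions").
  Rules : (Expr Act m → Lab Act → Expr Act m → Set) →
          Expr Act m → Lab Act → Expr Act m → Set
  Rules T 𝟘 a r = ⊥
  Rules T 𝟙 a r = ⊥
  Rules T (b · p) a r = (a ≡ b) × (r ≡ p)
  Rules T (p ⊕ q) a r = T p a r ⊎ T q a r
  Rules T (p ⨾ q) a r =
    (Σ (Expr Act m) λ p' → T p a p' × (r ≡ (p' ⨾ q)))
    ⊎ (Term p × (∀ b p' → ¬ T p b p') × T q a r)
  Rules T (var X) a r = T (Δ X) a r

  IsTransitionRelation : (Expr Act m → Lab Act → Expr Act m → Set) → Set
  IsTransitionRelation T = ∀ p a r → T p a r ⇔ Rules T p a r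

  TSPGraph : (Expr Act m → Lab Act → Expr Act m → Set) →
             Expr Act m → ProcessGraph Act
  TSPGraph T p = record
    { State = Expr Act m
    ; Step  = T
    ; root  = p
    ; Acc   = Term
    }

{-# OPTIONS --safe #-}
-- After aⁿ the automaton M is in a final configuration from which exactly n b's can follow, the
-- first one leading to the non-final state q₁.  A guarded specification only reaches states
-- e ⨾ r₁ ⨾ ⋯ ⨾ rₖ built from finitely many subterms of Δ, and in a final one all rᵢ terminate.
-- The first b after aⁿ⁺¹ is taken by one such component e, and by pigeonhole the same e serves
-- two counts i < j.  In the j-run the b-residual of e must perform all j remaining b's itself:
-- were it to terminate, the state would be accepting, while q₁ is not.  These b's lift to the
-- residual followed by the continuation of the i-run, a state related to q₁ with only i
-- symbols on the stack.
module Submission where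

open import Defs
open import Data.Nat using (ℕ; zero; suc; _<_; s≤s)
open import Data.Nat.Properties using (n<1+n)
open import Data.Fin using (Fin; zero; suc; toℕ)
open import Data.Fin.Properties using (pigeonhole)
open import Data.Bool using (Bool; true; false)
open import Data.Maybe using (Maybe; just; nothing)
open import Data.List using (List; []; _∷_; _++_; foldl; replicate; length; lookup; allFin; concatMap)
open import Data.List.Properties using (foldl-++)
open import Data.List.Membership.Propositional using (_∈_; lose)
open import Data.List.Membership.Propositional.Properties using (∈-++⁺ˡ; ∈-++⁺ʳ; ∈-allFin; ∈-concatMap⁺)
open import Data.List.Relation.Binary.Subset.Propositional using (_⊆_)
open import Data.List.Relation.Binary.Subset.Propositional.Properties using (∷⁺ʳ)
open import Data.List.Relation.Unary.Any using (here; there; index)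
open import Data.List.Relation.Unary.Any.Properties using (lookup-index)
open import Data.List.Relation.Unary.All as All using (All; []; _∷_)
open import Data.List.Relation.Unary.All.Properties using (++⁺; anti-mono)
open import Data.Product using (Σ; ∃₂; _×_; _,_; proj₂)
open import Data.Sum using (_⊎_; inj₁; inj₂)
open import Data.Empty using (⊥; ⊥-elim)
open import Function using (_∘_; case_of_)
open import Function.Bundles using (Equivalence)
open import Function.Definitions using (Injective)
open import Relation.Nullary using (¬_)
open import Relation.Binary.PropositionalEquality using (_≡_; _≢_; refl; sym; trans; cong; subst)

∈-pigeonhole : {A : Set} (xs : List A) (f : ℕ → A) → (∀ n → f n ∈ xs) →
               ∃₂ λ i j → i < j × f i ≡ f j
∈-pigeonhole xs f f∈xs
  with i , j , i<j , same-index ← pigeonhole (n<1+n (length xs)) (index ∘ f∈xs ∘ toℕ)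
  = toℕ i , toℕ j , i<j ,
    trans (lookup-index (f∈xs (toℕ i)))
          (trans (cong (lookup xs) same-index) (sym (lookup-index (f∈xs (toℕ j)))))

act-injective : {A : Set} {x y : A} → act x ≡ act y → x ≡ y
act-injective refl = refl

a b q₀ q₁ : Fin 2
a  = zero
b  = suc zero
q₀ = zero
q₁ = suc zero

⋆ : Fin 1
⋆ = zero

_─_[_/_]⟶_ : Fin 2 → Fin 2 → Maybe (Fin 1) → List (Fin 1) → Fin 2 → PDATrans 2 2 1
s ─ x [ d / w ]⟶ t = record { src = s ; lab = act x ; pop = d ; push = w ; tgt = t }

final : Fin 2 → Bool
final zero    = true
final (suc _) = false

M : PDA 2 2 1
M = record
  { trans = q₀ ─ a [ nothing / ⋆ ∷ [] ]⟶ q₀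
          ∷ q₀ ─ a [ just ⋆ / ⋆ ∷ ⋆ ∷ [] ]⟶ q₀
          ∷ q₀ ─ b [ just ⋆ / [] ]⟶ q₁
          ∷ q₁ ─ b [ just ⋆ / [] ]⟶ q₁
          ∷ []
  ; init  = q₀
  ; final = final
  }

stack : ℕ → List (Fin 1)
stack n = replicate n ⋆

data Move : Fin 2 × List (Fin 1) → Lab (Fin 2) → Fin 2 × List (Fin 1) → Set where
  push-first : Move (q₀ , []) (act a) (q₀ , ⋆ ∷ [])
  push       : ∀ {w} → Move (q₀ , ⋆ ∷ w) (act a) (q₀ , ⋆ ∷ ⋆ ∷ w)
  pop-first  : ∀ {w} → Move (q₀ , ⋆ ∷ w) (act b) (q₁ , w)
  pop        : ∀ {w} → Move (q₁ , ⋆ ∷ w) (act b) (q₁ , w)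

module _ {Act : Set} (ι : Fin 2 → Act) where

  move⇒step : ∀ {c l c'} → Move c l c' → PDAStep ι M c (mapLab ι l) c'
  move⇒step push-first = emptyStep (here refl) refl
  move⇒step push       = popStep (there (here refl)) refl
  move⇒step pop-first  = popStep (there (there (here refl))) refl
  move⇒step pop        = popStep (there (there (there (here refl)))) refl

  step⇒move : ∀ {c l c'} → PDAStep ι M c l c' →
              Σ (Lab (Fin 2)) λ l₀ → Move c l₀ c' × l ≡ mapLab ι l₀
  step⇒move (popStep (here refl) ())
  step⇒move (popStep (there (here refl)) refl)                 = _ , push , refl
  step⇒move (popStep (there (there (here refl))) refl)         = _ , pop-first , refl
  step⇒move (popStep (there (there (there (here refl)))) refl) = _ , pop , refl
  step⇒move (emptyStep (here refl) refl)                       = _ , push-first , refl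
  step⇒move (emptyStep (there (here refl)) ())
  step⇒move (emptyStep (there (there (here refl))) ())
  step⇒move (emptyStep (there (there (there (here refl)))) ())

  a-step : ∀ n → PDAStep ι M (q₀ , stack n) (act (ι a)) (q₀ , stack (suc n))
  a-step zero    = move⇒step push-first
  a-step (suc n) = move⇒step push

  q₀-b-step : Injective _≡_ _≡_ ι → ∀ {w c} →
              PDAStep ι M (q₀ , ⋆ ∷ w) (act (ι b)) c → c ≡ (q₁ , w)
  q₀-b-step ι-injective st with step⇒move st
  ... | _ , push , b≡a      = case ι-injective (act-injective b≡a) of λ ()
  ... | _ , pop-first , _   = refl

  q₁-step : ∀ i {l c} → PDAStep ι M (q₁ , stack i) l c →
            Σ ℕ λ i' → i ≡ suc i' × c ≡ (q₁ , stack i')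
  q₁-step i st with step⇒move st
  q₁-step zero    st | _ , () , _
  q₁-step (suc i) st | _ , pop , _ = i , refl , refl

module _ {Act : Set} {m : ℕ} where

  private
    E = Expr Act m

  _⨾*_ : E → List E → E
  p ⨾* qs = foldl _⨾_ p qs

  data _≼_ : E → E → Set where
    ≼-refl : ∀ {e} → e ≼ e
    ≼-·    : ∀ {e c p} → e ≼ p → e ≼ (c · p)
    ≼-⊕ˡ   : ∀ {e p q} → e ≼ p → e ≼ (p ⊕ q)
    ≼-⊕ʳ   : ∀ {e p q} → e ≼ q → e ≼ (p ⊕ q)
    ≼-⨾ˡ   : ∀ {e p q} → e ≼ p → e ≼ (p ⨾ q)
    ≼-⨾ʳ   : ∀ {e p q} → e ≼ q → e ≼ (p ⨾ q)

  ≼-trans : ∀ {x y z} → x ≼ y → y ≼ z → x ≼ z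
  ≼-trans h ≼-refl   = h
  ≼-trans h (≼-· k)  = ≼-· (≼-trans h k)
  ≼-trans h (≼-⊕ˡ k) = ≼-⊕ˡ (≼-trans h k)
  ≼-trans h (≼-⊕ʳ k) = ≼-⊕ʳ (≼-trans h k)
  ≼-trans h (≼-⨾ˡ k) = ≼-⨾ˡ (≼-trans h k)
  ≼-trans h (≼-⨾ʳ k) = ≼-⨾ʳ (≼-trans h k)

  subterms : E → List E
  subterms 𝟘       = 𝟘 ∷ []
  subterms 𝟙       = 𝟙 ∷ []
  subterms (c · p) = c · p ∷ subterms p
  subterms (p ⊕ q) = p ⊕ q ∷ subterms p ++ subterms q
  subterms (p ⨾ q) = p ⨾ q ∷ subterms p ++ subterms q
  subterms (var Y) = var Y ∷ []

  ≼⇒∈subterms : ∀ {e x} → e ≼ x → e ∈ subterms x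
  ≼⇒∈subterms {x = 𝟘}     ≼-refl = here refl
  ≼⇒∈subterms {x = 𝟙}     ≼-refl = here refl
  ≼⇒∈subterms {x = _ · _} ≼-refl = here refl
  ≼⇒∈subterms {x = _ ⊕ _} ≼-refl = here refl
  ≼⇒∈subterms {x = _ ⨾ _} ≼-refl = here refl
  ≼⇒∈subterms {x = var _} ≼-refl = here refl
  ≼⇒∈subterms (≼-· h)                = there (≼⇒∈subterms h)
  ≼⇒∈subterms (≼-⊕ˡ h)               = there (∈-++⁺ˡ (≼⇒∈subterms h))
  ≼⇒∈subterms {x = p ⊕ _} (≼-⊕ʳ h)   = there (∈-++⁺ʳ (subterms p) (≼⇒∈subterms h))
  ≼⇒∈subterms (≼-⨾ˡ h)               = there (∈-++⁺ˡ (≼⇒∈subterms h))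
  ≼⇒∈subterms {x = p ⨾ _} (≼-⨾ʳ h)   = there (∈-++⁺ʳ (subterms p) (≼⇒∈subterms h))

module Sequencing {Act : Set} {m : ℕ} {Δ : Spec Act m}
                  {T : Expr Act m → Lab Act → Expr Act m → Set}
                  (isT : IsTransitionRelation Δ T) where

  private
    E = Expr Act m

  step⇒rules : ∀ {p l r} → T p l r → Rules Δ T p l r
  step⇒rules {p} {l} {r} = Equivalence.to (isT p l r)

  rules⇒step : ∀ {p l r} → Rules Δ T p l r → T p l r
  rules⇒step {p} {l} {r} = Equivalence.from (isT p l r)

  ⨾*-term : ∀ {p} qs → Term Δ p → All (Term Δ) qs → Term Δ (p ⨾* qs)
  ⨾*-term []       tp _           = tp
  ⨾*-term (q ∷ qs) tp (tq ∷ tqs) = ⨾*-term qs (t⨾ tp tq) tqs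

  ⨾*-term⁻ : ∀ {p} qs → Term Δ (p ⨾* qs) → Term Δ p × All (Term Δ) qs
  ⨾*-term⁻ []       t = t , []
  ⨾*-term⁻ (q ∷ qs) t with ⨾*-term⁻ qs t
  ... | t⨾ tp tq , tqs = tp , tq ∷ tqs

  ⨾*-step-left : ∀ {p l p'} qs → T p l p' → T (p ⨾* qs) l (p' ⨾* qs)
  ⨾*-step-left []       t = t
  ⨾*-step-left (q ∷ qs) t = ⨾*-step-left qs (rules⇒step (inj₁ (_ , t , refl)))

  ⨾*-step-head : ∀ {p l r} qs → T (p ⨾* qs) l r →
                 (Σ E λ p' → T p l p' × r ≡ p' ⨾* qs) ⊎ Term Δ p
  ⨾*-step-head []       t = inj₁ (_ , t , refl)
  ⨾*-step-head (q ∷ qs) t with ⨾*-step-head qs t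
  ... | inj₂ (t⨾ tp _)  = inj₂ tp
  ... | inj₁ (_ , t' , r≡) with step⇒rules t'
  ...   | inj₁ (p' , tp , refl) = inj₁ (p' , tp , r≡)
  ...   | inj₂ (tp , _ , _)     = inj₂ tp

  record Decomposition (p : E) (qs : List E) (l : Lab Act) (r : E) : Set where
    constructor decomposition
    field
      head   : E
      head∈  : head ∈ p ∷ qs
      target : E
      rest   : List E
      step   : T head l target
      result : r ≡ target ⨾* rest
      lift   : ∀ {s} → T head l s → T (p ⨾* qs) l (s ⨾* rest)
      rest⊆  : rest ⊆ qs

  ⨾*-step-decompose : ∀ {l r} p qs → T (p ⨾* qs) l r → Decomposition p qs l r
  ⨾*-step-decompose p [] t = decomposition p (here refl) _ [] t refl (λ ts → ts) (λ ())
  ⨾*-step-decompose p (q ∷ qs) t with ⨾*-step-decompose (p ⨾ q) qs t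
  ... | decomposition h (there h∈) s rest st r≡ lift ⊆qs =
    decomposition h (there (there h∈)) s rest st r≡ lift (there ∘ ⊆qs)
  ... | decomposition _ (here refl) s rest st r≡ lift ⊆qs with step⇒rules st
  ...   | inj₁ (p' , tp , refl) =
    decomposition p (here refl) p' (q ∷ rest) tp r≡
      (λ ts → lift (rules⇒step (inj₁ (_ , ts , refl)))) (∷⁺ʳ q ⊆qs)
  ...   | inj₂ (tp , dead , tq) =
    decomposition q (there (here refl)) s rest tq r≡
      (λ ts → lift (rules⇒step (inj₂ (tp , dead , ts)))) (there ∘ ⊆qs)

module Components {Act : Set} {m : ℕ} (Δ : Spec Act m) where

  private
    E = Expr Act m

  Component : E → Set
  Component e = Σ (Fin m) λ Y → e ≼ Δ Y ⊎ e ≡ var Y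

  components : List E
  components = concatMap (λ Y → var Y ∷ subterms (Δ Y)) (allFin m)

  component∈components : ∀ {e} → Component e → e ∈ components
  component∈components (Y , inj₁ h) =
    ∈-concatMap⁺ _ (lose (∈-allFin Y) (there (≼⇒∈subterms h)))
  component∈components (Y , inj₂ refl) =
    ∈-concatMap⁺ _ (lose (∈-allFin Y) (here refl))

  data Stacked : E → Set where
    stacked : ∀ {e qs} → Component e → All Component qs → Stacked (e ⨾* qs)

  stacked-⨾* : ∀ {p qs} → Stacked p → All Component qs → Stacked (p ⨾* qs)
  stacked-⨾* {qs = qs'} (stacked {e} {qs} ce cqs) cqs' =
    subst Stacked (foldl-++ _⨾_ e qs qs') (stacked ce (++⁺ cqs cqs'))

  module _ (guarded : GuardedSpec Δ) {T : E → Lab Act → E → Set}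
           (isT : IsTransitionRelation Δ T) where

    open Sequencing isT

    guarded-step-stacked : ∀ {Y l s} e → Guarded e → e ≼ Δ Y → T e l s → Stacked s
    guarded-step-stacked 𝟘 _ _ t = ⊥-elim (step⇒rules t)
    guarded-step-stacked 𝟙 _ _ t = ⊥-elim (step⇒rules t)
    guarded-step-stacked {Y} (c · p) _ h t with step⇒rules t
    ... | _ , refl = stacked (Y , inj₁ (≼-trans (≼-· ≼-refl) h)) []
    guarded-step-stacked (p ⊕ q) (g⊕ gp gq) h t with step⇒rules t
    ... | inj₁ tp = guarded-step-stacked p gp (≼-trans (≼-⊕ˡ ≼-refl) h) tp
    ... | inj₂ tq = guarded-step-stacked q gq (≼-trans (≼-⊕ʳ ≼-refl) h) tq
    guarded-step-stacked {Y} (p ⨾ q) (g⨾ gp gq) h t with step⇒rules t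
    ... | inj₁ (_ , tp , refl) =
      stacked-⨾* (guarded-step-stacked p gp (≼-trans (≼-⨾ˡ ≼-refl) h) tp)
                 ((Y , inj₁ (≼-trans (≼-⨾ʳ ≼-refl) h)) ∷ [])
    ... | inj₂ (_ , _ , tq) = guarded-step-stacked q gq (≼-trans (≼-⨾ʳ ≼-refl) h) tq

    var-step-stacked : ∀ {l s} Z → T (var Z) l s → Stacked s
    var-step-stacked Z t = guarded-step-stacked (Δ Z) (guarded Z) ≼-refl (step⇒rules t)

    -- Below a prefix guardedness is lost, so the analysis above is repeated without it; an
    -- identifier hands over to its (guarded) right-hand side.
    subterm-step-stacked : ∀ {Y l s} e → e ≼ Δ Y → T e l s → Stacked s
    subterm-step-stacked 𝟘 _ t = ⊥-elim (step⇒rules t)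
    subterm-step-stacked 𝟙 _ t = ⊥-elim (step⇒rules t)
    subterm-step-stacked {Y} (c · p) h t with step⇒rules t
    ... | _ , refl = stacked (Y , inj₁ (≼-trans (≼-· ≼-refl) h)) []
    subterm-step-stacked (p ⊕ q) h t with step⇒rules t
    ... | inj₁ tp = subterm-step-stacked p (≼-trans (≼-⊕ˡ ≼-refl) h) tp
    ... | inj₂ tq = subterm-step-stacked q (≼-trans (≼-⊕ʳ ≼-refl) h) tq
    subterm-step-stacked {Y} (p ⨾ q) h t with step⇒rules t
    ... | inj₁ (_ , tp , refl) =
      stacked-⨾* (subterm-step-stacked p (≼-trans (≼-⨾ˡ ≼-refl) h) tp)
                 ((Y , inj₁ (≼-trans (≼-⨾ʳ ≼-refl) h)) ∷ [])
    ... | inj₂ (_ , _ , tq) = subterm-step-stacked q (≼-trans (≼-⨾ʳ ≼-refl) h) tq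
    subterm-step-stacked (var Z) _ t = var-step-stacked Z t

    component-step-stacked : ∀ {e l s} → Component e → T e l s → Stacked s
    component-step-stacked (_ , inj₁ h)    t = subterm-step-stacked _ h t
    component-step-stacked (Z , inj₂ refl) t = var-step-stacked Z t

    stacked-step : ∀ {t l r} → Stacked t → T t l r → Stacked r
    stacked-step (stacked {e} {qs} ce cqs) t
      with decomposition _ h∈ _ rest st refl _ rest⊆ ← ⨾*-step-decompose e qs t
      = stacked-⨾* (component-step-stacked (All.lookup (ce ∷ cqs) h∈) st)
                   (anti-mono rest⊆ cqs)

module Counterexample
  {Act : Set} (ι : Fin 2 → Act) (ι-injective : Injective _≡_ _≡_ ι)
  {m : ℕ} {Δ : Spec Act m} (guarded : GuardedSpec Δ)
  {T : Expr Act m → Lab Act → Expr Act m → Set} (isT : IsTransitionRelation Δ T)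
  (X : Fin m)
  {R : U (TSPGraph Δ T (var X)) (PDAGraph ι M) → U (TSPGraph Δ T (var X)) (PDAGraph ι M) → Set}
  (isB : IsBisimulation (TSPGraph Δ T (var X)) (PDAGraph ι M) R)
  (roots : R (inj₁ (var X)) (inj₂ (q₀ , [])))
  where

  open IsBisimulation isB
  open Sequencing isT
  open Components Δ

  private
    E = Expr Act m
    C = Fin 2 × List (Fin 1)

  _∼_ : E → C → Set
  t ∼ c = R (inj₁ t) (inj₂ c)

  simulate : ∀ {t c l t'} → t ∼ c → T t l t' → Σ C λ c' → PDAStep ι M c l c' × t' ∼ c'
  simulate t∼c tr with transfer t∼c (left tr)
  ... | inj₂ c' , right st , t'∼c' = c' , st , t'∼c'

  respond : ∀ {t c l c'} → t ∼ c → PDAStep ι M c l c' → Σ E λ t' → T t l t' × t' ∼ c'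
  respond t∼c st with transfer (symmetric t∼c) (right st)
  ... | inj₁ t' , left tr , c'∼t' = t' , tr , symmetric c'∼t'

  a-run : ∀ n → Σ E λ t → Stacked t × t ∼ (q₀ , stack n)
  a-run zero = var X , stacked (X , inj₂ refl) [] , roots
  a-run (suc n) with t , st , t∼ ← a-run n =
    let t' , tr , t'∼ = respond t∼ (a-step ι n) in t' , stacked-step guarded isT st tr , t'∼

  record BranchPoint (k : ℕ) : Set where
    field
      component       : E
      is-component    : Component component
      rest            : List E
      rest-terminates : All (Term Δ) rest
      target          : E
      step            : T component (act (ι b)) target
      related         : ∀ {s} → T component (act (ι b)) s → (s ⨾* rest) ∼ (q₁ , stack k)

  branch-point : ∀ k → BranchPoint k
  branch-point k
    with _ , stacked {e} {qs} ce cqs , t∼ ← a-run (suc k)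
    with _ , tr , _ ← respond t∼ (move⇒step ι pop-first)
    with decomposition h h∈ s rest st _ lift rest⊆ ← ⨾*-step-decompose e qs tr
    = record
        { component       = h
        ; is-component    = All.lookup (ce ∷ cqs) h∈
        ; rest            = rest
        ; rest-terminates = anti-mono rest⊆ (proj₂ (⨾*-term⁻ qs (accept (symmetric t∼) refl)))
        ; target          = s
        ; step            = st
        ; related         = related
        }
    where
      related : ∀ {s'} → T h (act (ι b)) s' → (s' ⨾* rest) ∼ (q₁ , stack k)
      related {s'} ts with _ , st' , ∼c ← simulate t∼ (lift ts)
        = subst ((s' ⨾* rest) ∼_) (q₀-b-step ι ι-injective st') ∼c

  b-runs-incomparable : ∀ {s} rest rest' i j → i < j →
                        (s ⨾* rest') ∼ (q₁ , stack j) → All (Term Δ) rest' →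
                        (s ⨾* rest) ∼ (q₁ , stack i) → ⊥
  b-runs-incomparable rest rest' i (suc j) (s≤s i≤j) ∼j rest'-term ∼i
    with _ , tr , ∼j' ← respond ∼j (move⇒step ι pop)
    with ⨾*-step-head rest' tr
  ... | inj₂ s-term = case accept ∼j (⨾*-term rest' s-term rest'-term) of λ ()
  ... | inj₁ (s' , ts , refl)
    with _ , st , ∼c ← simulate ∼i (⨾*-step-left rest ts)
    with i' , refl , refl ← q₁-step ι i st
    = b-runs-incomparable rest rest' i' j i≤j ∼j' rest'-term ∼c

  distinct-heights-distinct-components : ∀ {i j} → i < j → (I : BranchPoint i) (J : BranchPoint j) →
                                         BranchPoint.component I ≢ BranchPoint.component J
  distinct-heights-distinct-components {i} {j} i<j I J refl =
    b-runs-incomparable I.rest J.rest i j i<j (J.related J.step) J.rest-terminates (I.related J.step)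
    where
      module I = BranchPoint I
      module J = BranchPoint J

  absurd : ⊥
  absurd =
    let i , j , i<j , same = ∈-pigeonhole components component-at
                               (component∈components ∘ BranchPoint.is-component ∘ branch-point)
    in distinct-heights-distinct-components i<j (branch-point i) (branch-point j) same
    where
      component-at : ℕ → E
      component-at k = BranchPoint.component (branch-point k)

theorem6p3 : Σ ℕ λ n → Σ ℕ λ k → Σ (PDA 2 n k) λ M →
    (Act : Set) (ι : Fin n → Act) → Injective _≡_ _≡_ ι →
    (m : ℕ) (Δ : Spec Act m) → GuardedSpec Δ →
    (T : Expr Act m → Lab Act → Expr Act m → Set) → IsTransitionRelation Δ T →
    (X : Fin m) → ¬ Bisimilar (TSPGraph Δ T (var X)) (PDAGraph ι M)
theorem6p3 = 2 , 1 , M , λ Act ι ι-injective m Δ guarded T isT X (R , isB , roots) →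
  Counterexample.absurd ι ι-injective guarded isT X isB roots
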